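{- Let $k\geqslant 7$ and let $G$ be a $C_k$-saturated graph. Let $u_0u_1\ldots u_{k-4}$ and $v_0v_1\ldots v_{k-4}$ be two vertex-disjoint paths in $G$ all of whose vertices have degree $2$ in $G$. Then $u_0$ and $v_0$ have no common neighbor.
   Context: All graphs are finite, simple, undirected. $C_k$ is the cycle on $k$ vertices. $G$ is $C_k$-saturated if $G$ contains no subgraph isomorphic to $C_k$ and adding any edge between two nonadjacent vertices creates one. -}

module Defs where

open import Data.Nat using (ℕ; zero; suc; _+_; _≤_)
open import Data.Fin using (Fin; toℕ)
open import Data.Fin.Properties using (_≟_)
open import Data.Bool using (Bool; true; false; _∨_; _∧_)
open import Data.List using (List; length; filter)
open import Data.List using () renaming (allFin to allFinL)
open import Data.Product using (Σ; _×_; ∃; _,_)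
open import Data.Empty using (⊥)
open import Relation.Nullary using (¬_; does)
open import Relation.Binary.PropositionalEquality using (_≡_; _≢_)
open import Function.Definitions using (Injective)
open import Data.Nat.DivMod using (_%_)
open import Data.Fin using (fromℕ<)
open import Data.Nat.DivMod using (m%n<n)

record Graph (n : ℕ) : Set where
  field
    adj   : Fin n → Fin n → Bool
    sym   : ∀ x y → adj x y ≡ adj y x
    irrefl : ∀ x → adj x x ≡ false
open Graph public

Adjacent : ∀ {n} → Graph n → Fin n → Fin n → Set
Adjacent G x y = adj G x y ≡ true

degree : ∀ {n} → Graph n → Fin n → ℕ
degree {n} G x = length (filter (λ y → adj G x y Data.Bool.≟ true) (allFinL n))

next : ∀ {k} → Fin (suc k) → Fin (suc k)
next {k} i = fromℕ< (m%n<n (suc (toℕ i)) (suc k))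

HasCycle : ∀ {n} → ℕ → Graph n → Set
HasCycle {n} zero G = ⊥
HasCycle {n} (suc k) G =
  Σ (Fin (suc k) → Fin n) λ f →
    Injective _≡_ _≡_ f × (∀ i → Adjacent G (f i) (f (next i)))

addEdge : ∀ {n} (G : Graph n) (x y : Fin n) → x ≢ y → Graph n
addEdge {n} G x y x≢y = record
  { adj = λ a b → adj G a b ∨ (isPair a b ∨ isPair b a)
  ; sym = symm
  ; irrefl = irr }
  where
  open import Data.Bool.Properties using (∨-comm)
  open import Relation.Binary.PropositionalEquality using (refl; cong₂; cong)
  open import Data.Bool using (if_then_else_)
  isPair : Fin n → Fin n → Bool
  isPair a b = does (a ≟ x) ∧ does (b ≟ y)
  symm : ∀ a b → (adj G a b ∨ (isPair a b ∨ isPair b a)) ≡ (adj G b a ∨ (isPair b a ∨ isPair a b))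
  symm a b = cong₂ _∨_ (Graph.sym G a b) (∨-comm (isPair a b) (isPair b a))
  irr : ∀ a → (adj G a a ∨ (isPair a a ∨ isPair a a)) ≡ false
  irr a with Graph.irrefl G a | a ≟ x | a ≟ y
  ... | e | Relation.Nullary.yes refl | Relation.Nullary.yes refl with x≢y refl
  ...   | ()
  irr a | e | Relation.Nullary.yes _ | Relation.Nullary.no _ rewrite e = refl
  irr a | e | Relation.Nullary.no _ | _ rewrite e = refl

Saturated : ∀ {n} → ℕ → Graph n → Set
Saturated k G =
  ¬ HasCycle k G ×
  (∀ x y (x≢y : x ≢ y) → ¬ Adjacent G x y → HasCycle k (addEdge G x y x≢y))

IsPath : ∀ {n} (G : Graph n) (m : ℕ) → (Fin (suc m) → Fin n) → Set
IsPath G m p =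
  Injective _≡_ _≡_ p ×
  (∀ (i : Fin m) → Adjacent G (p (Data.Fin.inject₁ i)) (p (Data.Fin.suc i)))

{-# OPTIONS --safe #-}
module Submission where

-- Let w be a common neighbour of u 0 and v 0, and m = k - 4. Saturation turns every non-edge into a
-- path on k = m + 4 vertices, and a path entering a thread of degree-2 vertices at an end must run
-- along it. A path from u 0 to v 0 leaves through u 1 or w and arrives through v 1 or w; it has no
-- room for both threads, so it is u 0, w, z, v m, …, v 0 or its mirror image, and z is a common
-- neighbour of w and v m (or of w and u m). A path from u 0 to v 1 cannot start with w, since
-- replacing u 0 by v 0 would close a C_k in G; so it runs along u and ends with w, v 0, v 1 or, only
-- when m = 3, with v m, …, v 1. Hence u m ~ w or u m ~ v m, and likewise v m ~ w or v m ~ u m. At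
-- the end sharing the neighbour z with w, either alternative gives a degree-2 vertex three neighbours.

open import Defs hiding (sym)
open import Data.Nat using (ℕ; zero; suc; _+_; _∸_; _≤_; _<_; z≤n; s≤s; s≤s⁻¹; z<s; _≤?_; _<?_; NonZero)
open import Data.Nat.Properties
  using ( suc-injective; ≤-refl; ≤-trans; ≤-antisym; ≤-total; <⇒≤; <⇒≢; ≮⇒≥; ≰⇒>; ≤-<-trans; <-irrefl
        ; m≤n⇒m≤1+n; n≤1+n; m≤n+m; m≤n⇒m<n∨m≡n; +-identityʳ; +-suc; +-assoc; +-cancelˡ-≡; +-mono-<
        ; m∸n≤m; m∸n≡0⇒m≤n; m∸n+n≡m; m+[n∸m]≡n; m+n∸n≡m; n∸n≡0; +-∸-assoc; ∸-cancelˡ-≡; ∸-monoʳ-<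
        ; m<n+o⇒m∸n<o; m⊓n≤n; m≤n⇒m⊓n≡m )
open import Data.Nat.DivMod
  using (_%_; _mod_; m%n<n; m<n⇒m%n≡m; m%n%n≡m%n; %-distribˡ-+; [m+n]%n≡m%n; m≤n⇒[n∸m]%m≡n%m; n%n≡0)
open import Data.Fin using (Fin; zero; suc; toℕ; fromℕ<; inject₁)
open import Data.Fin.Properties
  using (_≟_; toℕ-injective; toℕ-fromℕ<; fromℕ<-cong; toℕ-inject₁; toℕ<n; toℕ≤pred[n]; ¬∀⟶∃¬)
open import Data.Bool using (true; false)
import Data.Bool as Bool
open import Data.List using (length; filter; allFin)
open import Data.List.Relation.Unary.Any using (here; there)
open import Data.List.Membership.Propositional using (_∈_)
open import Data.List.Membership.Propositional.Properties using (∈-length; ∈-filter⁺; ∈-allFin)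
open import Data.Product using (∃; _×_; _,_; proj₁; proj₂)
open import Data.Sum using (_⊎_; inj₁; inj₂; [_,_])
open import Function using (_∘_)
open import Relation.Nullary using (¬_; yes; no)
open import Relation.Nullary.Negation using (contradiction)
open import Relation.Binary.PropositionalEquality
  using (_≡_; _≢_; refl; sym; trans; cong; subst; subst₂; module ≡-Reasoning)
open ≡-Reasoning

module _ {A : Set} where

  distinct-∈⇒2≤length : ∀ {a b : A} {xs} → a ∈ xs → b ∈ xs → a ≢ b → 2 ≤ length xs
  distinct-∈⇒2≤length (here refl) (here refl) a≢b = contradiction refl a≢b
  distinct-∈⇒2≤length (here refl) (there b∈)  _   = s≤s (∈-length b∈)
  distinct-∈⇒2≤length (there a∈)  (here refl) _   = s≤s (∈-length a∈)
  distinct-∈⇒2≤length (there a∈)  (there b∈)  a≢b = m≤n⇒m≤1+n (distinct-∈⇒2≤length a∈ b∈ a≢b)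

  distinct-∈⇒3≤length : ∀ {a b c : A} {xs} → a ∈ xs → b ∈ xs → c ∈ xs →
                        a ≢ b → a ≢ c → b ≢ c → 3 ≤ length xs
  distinct-∈⇒3≤length (here refl) (here refl) _ a≢b _ _ = contradiction refl a≢b
  distinct-∈⇒3≤length (here refl) _ (here refl) _ a≢c _ = contradiction refl a≢c
  distinct-∈⇒3≤length _ (here refl) (here refl) _ _ b≢c = contradiction refl b≢c
  distinct-∈⇒3≤length (here refl) (there b∈) (there c∈) _ _ b≢c = s≤s (distinct-∈⇒2≤length b∈ c∈ b≢c)
  distinct-∈⇒3≤length (there a∈) (here refl) (there c∈) _ a≢c _ = s≤s (distinct-∈⇒2≤length a∈ c∈ a≢c)
  distinct-∈⇒3≤length (there a∈) (there b∈) (here refl) a≢b _ _ = s≤s (distinct-∈⇒2≤length a∈ b∈ a≢b)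
  distinct-∈⇒3≤length (there a∈) (there b∈) (there c∈) a≢b a≢c b≢c =
    m≤n⇒m≤1+n (distinct-∈⇒3≤length a∈ b∈ c∈ a≢b a≢c b≢c)

  infix 4 _≐_
  _≐_ : A × A → A × A → Set
  (a , b) ≐ (c , d) = (a ≡ c × b ≡ d) ⊎ (a ≡ d × b ≡ c)

  ≐-sym : ∀ {a b c d} → (a , b) ≐ (c , d) → (c , d) ≐ (a , b)
  ≐-sym (inj₁ (refl , refl)) = inj₁ (refl , refl)
  ≐-sym (inj₂ (refl , refl)) = inj₂ (refl , refl)

  ≐-trans : ∀ {a b c d e f} → (a , b) ≐ (c , d) → (c , d) ≐ (e , f) → (a , b) ≐ (e , f)
  ≐-trans (inj₁ (refl , refl)) cd≐ef                = cd≐ef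
  ≐-trans (inj₂ (refl , refl)) (inj₁ (refl , refl)) = inj₂ (refl , refl)
  ≐-trans (inj₂ (refl , refl)) (inj₂ (refl , refl)) = inj₁ (refl , refl)

  _◂_ : A → (ℕ → A) → ℕ → A
  (x ◂ p) zero    = x
  (x ◂ p) (suc i) = p i

module _ {d : ℕ} .{{_ : NonZero d}} where

  [1+m%d]%d≡[1+m]%d : ∀ m → suc (m % d) % d ≡ suc m % d
  [1+m%d]%d≡[1+m]%d m = begin
    (1 + m % d) % d          ≡⟨ %-distribˡ-+ 1 (m % d) d ⟩
    (1 % d + m % d % d) % d  ≡⟨ cong (λ r → (1 % d + r) % d) (m%n%n≡m%n m d) ⟩
    (1 % d + m % d) % d      ≡⟨ %-distribˡ-+ 1 m d ⟨
    (1 + m) % d              ∎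

  -- r + e < 2d, so reducing it modulo d subtracts d at most once
  [r+e]%d≡r⇒e≡0 : ∀ {r e} → r < d → e < d → (r + e) % d ≡ r → e ≡ 0
  [r+e]%d≡r⇒e≡0 {r} {e} r<d e<d [r+e]%d≡r with r + e <? d
  ... | yes r+e<d = +-cancelˡ-≡ r e 0 (begin
    r + e        ≡⟨ m<n⇒m%n≡m r+e<d ⟨
    (r + e) % d  ≡⟨ [r+e]%d≡r ⟩
    r            ≡⟨ +-identityʳ r ⟨
    r + 0        ∎)
  ... | no r+e≮d = contradiction (+-cancelˡ-≡ r e d r+e≡r+d) (<⇒≢ e<d)
    where
    d≤r+e : d ≤ r + e
    d≤r+e = ≮⇒≥ r+e≮d
    r+e≡r+d : r + e ≡ r + d
    r+e≡r+d = begin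
      r + e                ≡⟨ m∸n+n≡m d≤r+e ⟨
      r + e ∸ d + d        ≡⟨ cong (_+ d) (m<n⇒m%n≡m (m<n+o⇒m∸n<o (r + e) d (+-mono-< r<d e<d))) ⟨
      (r + e ∸ d) % d + d  ≡⟨ cong (_+ d) (m≤n⇒[n∸m]%m≡n%m d≤r+e) ⟩
      (r + e) % d + d      ≡⟨ cong (_+ d) [r+e]%d≡r ⟩
      r + d                ∎

  private
    +-%-injectiveʳ-≤ : ∀ c {s t} → s ≤ t → t < d → (c + s) % d ≡ (c + t) % d → s ≡ t
    +-%-injectiveʳ-≤ c {s} {t} s≤t t<d eq = ≤-antisym s≤t (m∸n≡0⇒m≤n t∸s≡0)
      where
      t∸s<d : t ∸ s < d
      t∸s<d = ≤-<-trans (m∸n≤m t s) t<d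
      t∸s≡0 : t ∸ s ≡ 0
      t∸s≡0 = [r+e]%d≡r⇒e≡0 (m%n<n (c + s) d) t∸s<d (begin
        ((c + s) % d + (t ∸ s)) % d      ≡⟨ cong (λ r → ((c + s) % d + r) % d) (m<n⇒m%n≡m t∸s<d) ⟨
        ((c + s) % d + (t ∸ s) % d) % d  ≡⟨ %-distribˡ-+ (c + s) (t ∸ s) d ⟨
        (c + s + (t ∸ s)) % d            ≡⟨ cong (_% d) (+-assoc c s (t ∸ s)) ⟩
        (c + (s + (t ∸ s))) % d          ≡⟨ cong (λ r → (c + r) % d) (m+[n∸m]≡n s≤t) ⟩
        (c + t) % d                      ≡⟨ eq ⟨
        (c + s) % d                      ∎)

  +-%-injectiveʳ : ∀ c {s t} → s < d → t < d → (c + s) % d ≡ (c + t) % d → s ≡ t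
  +-%-injectiveʳ c {s} {t} s<d t<d eq with ≤-total s t
  ... | inj₁ s≤t = +-%-injectiveʳ-≤ c s≤t t<d eq
  ... | inj₂ t≤s = sym (+-%-injectiveʳ-≤ c t≤s s<d (sym eq))

module _ {K : ℕ} where

  rotate : Fin (suc K) → ℕ → Fin (suc K)
  rotate i t = (suc (toℕ i) + t) mod suc K

  rotate-zero : ∀ i → rotate i 0 ≡ next i
  rotate-zero i = fromℕ<-cong _ _ (cong (_% suc K) (+-identityʳ (suc (toℕ i)))) _ _

  rotate-suc : ∀ i t → rotate i (suc t) ≡ next (rotate i t)
  rotate-suc i t = fromℕ<-cong _ _ (begin
    (suc (toℕ i) + suc t) % suc K            ≡⟨ cong (_% suc K) (+-suc (suc (toℕ i)) t) ⟩
    suc (suc (toℕ i) + t) % suc K            ≡⟨ [1+m%d]%d≡[1+m]%d {d = suc K} (suc (toℕ i) + t) ⟨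
    suc ((suc (toℕ i) + t) % suc K) % suc K  ≡⟨ cong (λ r → suc r % suc K) (toℕ-fromℕ< _) ⟨
    suc (toℕ (rotate i t)) % suc K           ∎) _ _

  rotate-last : ∀ i → rotate i K ≡ i
  rotate-last i = toℕ-injective (begin
    toℕ (rotate i K)           ≡⟨ toℕ-fromℕ< _ ⟩
    (suc (toℕ i) + K) % suc K  ≡⟨ cong (_% suc K) (+-suc (toℕ i) K) ⟨
    (toℕ i + suc K) % suc K    ≡⟨ [m+n]%n≡m%n (toℕ i) (suc K) ⟩
    toℕ i % suc K              ≡⟨ m<n⇒m%n≡m (toℕ<n i) ⟩
    toℕ i                      ∎)

  rotate-injective : ∀ i {s t} → s ≤ K → t ≤ K → rotate i s ≡ rotate i t → s ≡ t
  rotate-injective i s≤K t≤K eq = +-%-injectiveʳ (suc (toℕ i)) (s≤s s≤K) (s≤s t≤K)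
    (trans (sym (toℕ-fromℕ< _)) (trans (cong toℕ eq) (toℕ-fromℕ< _)))

module _ {m : ℕ} where

  clamp : ℕ → Fin (suc m)
  clamp t = fromℕ< (s≤s (m⊓n≤n t m))

  toℕ-clamp : ∀ {t} → t ≤ m → toℕ (clamp t) ≡ t
  toℕ-clamp t≤m = trans (toℕ-fromℕ< _) (m≤n⇒m⊓n≡m t≤m)

module _ {n : ℕ} (G : Graph n) where

  infix 4 _~_
  _~_ : Fin n → Fin n → Set
  x ~ y = Adjacent G x y

  ~-sym : ∀ {x y} → x ~ y → y ~ x
  ~-sym {x} {y} x~y = trans (Graph.sym G y x) x~y

  ~⇒≢ : ∀ {x y} → x ~ y → x ≢ y
  ~⇒≢ {x} x~x refl = contradiction (trans (sym x~x) (irrefl G x)) λ ()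

  CommonNeighbour : Fin n → Fin n → Set
  CommonNeighbour x y = ∃ λ z → x ~ z × y ~ z

  3≤degree : ∀ {x a b c} → x ~ a → x ~ b → x ~ c → a ≢ b → a ≢ c → b ≢ c → 3 ≤ degree G x
  3≤degree {x} x~a x~b x~c = distinct-∈⇒3≤length (neighbour∈ x~a) (neighbour∈ x~b) (neighbour∈ x~c)
    where
    neighbour∈ : ∀ {y} → x ~ y → y ∈ filter (λ z → adj G x z Bool.≟ true) (allFin n)
    neighbour∈ = ∈-filter⁺ (λ z → adj G x z Bool.≟ true) (∈-allFin _)

  degree≡2⇒neighbour : ∀ {x a b c} → degree G x ≡ 2 → x ~ a → x ~ b → a ≢ b → x ~ c → c ≡ a ⊎ c ≡ b
  degree≡2⇒neighbour {a = a} {b} {c} deg≡2 x~a x~b a≢b x~c with c ≟ a | c ≟ b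
  ... | yes c≡a | _       = inj₁ c≡a
  ... | no _    | yes c≡b = inj₂ c≡b
  ... | no c≢a  | no c≢b  =
    contradiction (subst (3 ≤_) deg≡2 (3≤degree x~a x~b x~c a≢b (c≢a ∘ sym) (c≢b ∘ sym))) (<-irrefl refl)

  addEdge-new≐ : ∀ {x y a b} (x≢y : x ≢ y) → Adjacent (addEdge G x y x≢y) a b → ¬ a ~ b → (a , b) ≐ (x , y)
  addEdge-new≐ {x} {y} {a} {b} _ a~b a≁b with adj G a b | a ≟ x | b ≟ y | b ≟ x | a ≟ y
  ... | true  | _       | _       | _       | _       = contradiction refl a≁b
  ... | false | yes a≡x | yes b≡y | _       | _       = inj₁ (a≡x , b≡y)
  ... | false | _       | _       | yes b≡x | yes a≡y = inj₂ (a≡y , b≡x)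
  ... | false | no _    | _       | no _    | _       = contradiction a~b λ ()
  ... | false | no _    | _       | yes _   | no _    = contradiction a~b λ ()
  ... | false | yes _   | no _    | no _    | _       = contradiction a~b λ ()
  ... | false | yes _   | no _    | yes _   | no _    = contradiction a~b λ ()

  -- The path p 0, …, p M, indexed by ℕ so that reversing and shifting are plain arithmetic.
  record Path (M : ℕ) (p : ℕ → Fin n) : Set where
    field
      injective : ∀ i j → i ≤ M → j ≤ M → p i ≡ p j → i ≡ j
      adjacent  : ∀ i → i < M → p i ~ p (suc i)
  open Path

  isPath⇒path : ∀ {m f} → IsPath G m f → Path m (f ∘ clamp)
  isPath⇒path {m} {f} (f-injective , f-adjacent) = record
    { injective = λ i j i≤m j≤m eq →
        trans (sym (toℕ-clamp i≤m)) (trans (cong toℕ (f-injective eq)) (toℕ-clamp j≤m))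
    ; adjacent  = λ i i<m → subst₂ (λ a b → f a ~ f b) (sym (clamp≡inject₁ i<m)) (sym (clamp≡suc i<m))
                                   (f-adjacent (fromℕ< i<m)) }
    where
    clamp≡inject₁ : ∀ {i} (i<m : i < m) → clamp i ≡ inject₁ (fromℕ< i<m)
    clamp≡inject₁ i<m =
      toℕ-injective (trans (toℕ-clamp (<⇒≤ i<m)) (sym (trans (toℕ-inject₁ _) (toℕ-fromℕ< i<m))))
    clamp≡suc : ∀ {i} (i<m : i < m) → clamp (suc i) ≡ suc (fromℕ< i<m)
    clamp≡suc i<m = toℕ-injective (trans (toℕ-clamp i<m) (sym (cong suc (toℕ-fromℕ< i<m))))

  reverse : ∀ {M p} → Path M p → Path M (λ i → p (M ∸ i))
  reverse {M} {p} π = record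
    { injective = λ i j i≤M j≤M eq →
        ∸-cancelˡ-≡ i≤M j≤M (injective π _ _ (m∸n≤m M i) (m∸n≤m M j) eq)
    ; adjacent  = λ i i<M → subst (λ l → p l ~ p (M ∸ suc i)) (sym (+-∸-assoc 1 i<M))
                                  (~-sym (adjacent π (M ∸ suc i) (∸-monoʳ-< z<s i<M))) }

  tail : ∀ {M p} → Path (suc M) p → Path M (p ∘ suc)
  tail π = record
    { injective = λ i j i≤M j≤M eq → suc-injective (injective π _ _ (s≤s i≤M) (s≤s j≤M) eq)
    ; adjacent  = λ i i<M → adjacent π (suc i) (s≤s i<M) }

  cons : ∀ {M p z} → Path M p → (∀ i → i ≤ M → p i ≢ z) → z ~ p 0 → Path (suc M) (z ◂ p)
  cons {M} {p} {z} π z∉p z~p₀ = record { injective = injective′ ; adjacent = adjacent′ }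
    where
    injective′ : ∀ i j → i ≤ suc M → j ≤ suc M → (z ◂ p) i ≡ (z ◂ p) j → i ≡ j
    injective′ zero    zero    _   _   _  = refl
    injective′ zero    (suc j) _   j≤M eq = contradiction (sym eq) (z∉p j (s≤s⁻¹ j≤M))
    injective′ (suc i) zero    i≤M _   eq = contradiction eq (z∉p i (s≤s⁻¹ i≤M))
    injective′ (suc i) (suc j) i≤M j≤M eq = cong suc (injective π i j (s≤s⁻¹ i≤M) (s≤s⁻¹ j≤M) eq)
    adjacent′ : ∀ i → i < suc M → (z ◂ p) i ~ (z ◂ p) (suc i)
    adjacent′ zero    _   = z~p₀
    adjacent′ (suc i) i<M = adjacent π i (s≤s⁻¹ i<M)

  close : ∀ {K p} → Path K p → p K ~ p 0 → HasCycle (suc K) G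
  close {K} {p} π p_K~p₀ =
    p ∘ toℕ , (λ eq → toℕ-injective (injective π _ _ (toℕ≤pred[n] _) (toℕ≤pred[n] _) eq)) , edge
    where
    edge : ∀ i → p (toℕ i) ~ p (toℕ (next i))
    edge i with m≤n⇒m<n∨m≡n (toℕ≤pred[n] i)
    ... | inj₁ i<K = subst (λ l → p (toℕ i) ~ p l)
                           (sym (trans (toℕ-fromℕ< _) (m<n⇒m%n≡m (s≤s i<K)))) (adjacent π _ i<K)
    ... | inj₂ i≡K = subst₂ (λ a b → p a ~ p b) (sym i≡K) (sym next-i≡0) p_K~p₀
      where
      next-i≡0 : toℕ (next i) ≡ 0
      next-i≡0 = trans (toℕ-fromℕ< _) (trans (cong (λ l → suc l % suc K) i≡K) (n%n≡0 (suc K)))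

  Unbranched : ℕ → (ℕ → Fin n) → Set
  Unbranched M c = ∀ t → suc t < M → ∀ {z} → c (suc t) ~ z → z ≡ c t ⊎ z ≡ c (suc (suc t))

  degree≡2⇒unbranched : ∀ {M c} → Path M c → (∀ i → i ≤ M → degree G (c i) ≡ 2) → Unbranched M c
  degree≡2⇒unbranched π deg≡2 t t+2≤M =
    degree≡2⇒neighbour (deg≡2 (suc t) (<⇒≤ t+2≤M)) (~-sym (adjacent π t (<⇒≤ t+2≤M)))
      (adjacent π (suc t) t+2≤M) (λ eq → contradiction (injective π _ _ (<⇒≤ (<⇒≤ t+2≤M)) t+2≤M eq) λ ())

  follow : ∀ {L M q c} → Path L q → M ≤ L → Unbranched M c →
           q 0 ≡ c 0 → q 1 ≡ c 1 → ∀ t → t ≤ M → q t ≡ c t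
  follow {L} {M} {q} {c} π M≤L c-unbranched q₀≡c₀ q₁≡c₁ = agree
    where
    within : ∀ {i} → i ≤ M → i ≤ L
    within i≤M = ≤-trans i≤M M≤L
    next-agrees : ∀ t → suc t < M → q t ≡ c t → q (suc t) ≡ c (suc t) → q (suc (suc t)) ≡ c (suc (suc t))
    next-agrees t t+2≤M qₜ≡cₜ qₜ₊₁≡cₜ₊₁
      with c-unbranched t t+2≤M (subst (_~ q (suc (suc t))) qₜ₊₁≡cₜ₊₁ (adjacent π (suc t) (within t+2≤M)))
    ... | inj₂ qₜ₊₂≡cₜ₊₂ = qₜ₊₂≡cₜ₊₂
    ... | inj₁ qₜ₊₂≡cₜ   = contradiction
      (injective π _ _ (within t+2≤M) (within (<⇒≤ (<⇒≤ t+2≤M))) (trans qₜ₊₂≡cₜ (sym qₜ≡cₜ))) λ ()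
    agree-pair : ∀ t → suc t ≤ M → q t ≡ c t × q (suc t) ≡ c (suc t)
    agree-pair zero    _     = q₀≡c₀ , q₁≡c₁
    agree-pair (suc t) t+2≤M with agree-pair t (<⇒≤ t+2≤M)
    ... | qₜ≡cₜ , qₜ₊₁≡cₜ₊₁ = qₜ₊₁≡cₜ₊₁ , next-agrees t t+2≤M qₜ≡cₜ qₜ₊₁≡cₜ₊₁
    agree : ∀ t → t ≤ M → q t ≡ c t
    agree zero    _     = q₀≡c₀
    agree (suc t) t+1≤M = proj₂ (agree-pair t t+1≤M)

  saturated⇒path : ∀ {K} → 2 ≤ K → Saturated (suc K) G → ∀ {x y} → x ≢ y → ¬ x ~ y →
                   ∃ λ p → Path K p × p 0 ≡ x × p K ≡ y
  saturated⇒path {K} 2≤K (Cₖ-free , saturated) {x} {y} x≢y x≁y with saturated x y x≢y x≁y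
  ... | f , f-injective , f-edge = orient closing-edge
    where
    missing : ∃ λ i → ¬ f i ~ f (next i)
    missing = ¬∀⟶∃¬ (suc K) _ (λ i → adj G (f i) (f (next i)) Bool.≟ true)
                    (λ f-edge-in-G → Cₖ-free (f , f-injective , f-edge-in-G))
    i = proj₁ missing
    p : ℕ → Fin n
    p t = f (rotate i t)
    closing-edge : (p K , p 0) ≐ (x , y)
    closing-edge = subst₂ (λ a b → (a , b) ≐ (x , y))
                          (cong f (sym (rotate-last i))) (cong f (sym (rotate-zero i)))
                          (addEdge-new≐ x≢y (f-edge i) (proj₂ missing))
    p-injective : ∀ s t → s ≤ K → t ≤ K → p s ≡ p t → s ≡ t
    p-injective s t s≤K t≤K eq = rotate-injective i s≤K t≤K (f-injective eq)
    p-edge⁺ : ∀ t → Adjacent (addEdge G x y x≢y) (p t) (p (suc t))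
    p-edge⁺ t =
      subst (λ l → Adjacent (addEdge G x y x≢y) (p t) (f l)) (sym (rotate-suc i t)) (f-edge (rotate i t))
    -- xy is the edge from p K back to p 0, so it can be an edge of p only if K = 1
    p-adjacent : ∀ t → t < K → p t ~ p (suc t)
    p-adjacent t t<K with adj G (p t) (p (suc t)) Bool.≟ true
    ... | yes pₜ~pₜ₊₁ = pₜ~pₜ₊₁
    ... | no pₜ≁pₜ₊₁ with ≐-trans (addEdge-new≐ x≢y (p-edge⁺ t) pₜ≁pₜ₊₁) (≐-sym closing-edge)
    ...   | inj₁ (pₜ≡p_K , _)       = contradiction (p-injective t K (<⇒≤ t<K) ≤-refl pₜ≡p_K) (<⇒≢ t<K)
    ...   | inj₂ (pₜ≡p₀ , pₜ₊₁≡p_K) = contradiction (trans (sym (cong suc t≡0)) t+1≡K) (<⇒≢ 2≤K)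
      where
      t≡0 : t ≡ 0
      t≡0 = p-injective t 0 (<⇒≤ t<K) z≤n pₜ≡p₀
      t+1≡K : suc t ≡ K
      t+1≡K = p-injective (suc t) K t<K ≤-refl pₜ₊₁≡p_K
    π : Path K p
    π = record { injective = p-injective ; adjacent = p-adjacent }
    orient : (p K , p 0) ≐ (x , y) → ∃ λ q → Path K q × q 0 ≡ x × q K ≡ y
    orient (inj₁ (p_K≡x , p₀≡y)) = (λ t → p (K ∸ t)) , reverse π , p_K≡x , trans (cong p (n∸n≡0 K)) p₀≡y
    orient (inj₂ (p_K≡y , p₀≡x)) = p , π , p₀≡x , p_K≡y

  module Thread {m : ℕ} {a b : ℕ → Fin n} {w : Fin n} (2≤m : 2 ≤ m)
                (a-path : Path m a) (a-degree : ∀ i → i ≤ m → degree G (a i) ≡ 2)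
                (a≢b : ∀ i j → i ≤ m → j ≤ m → a i ≢ b j)
                (a₀~w : a 0 ~ w) (b₀~w : b 0 ~ w) where

    unbranched : Unbranched m a
    unbranched = degree≡2⇒unbranched a-path a-degree

    a₁≢w : a 1 ≢ w
    a₁≢w a₁≡w with unbranched 0 2≤m (subst (_~ b 0) (sym a₁≡w) (~-sym b₀~w))
    ... | inj₁ b₀≡a₀ = a≢b 0 0 z≤n z≤n (sym b₀≡a₀)
    ... | inj₂ b₀≡a₂ = a≢b 2 0 2≤m z≤n (sym b₀≡a₂)

    a≢w : ∀ i → i ≤ m → a i ≢ w
    a≢w zero          _      = ~⇒≢ a₀~w
    a≢w (suc zero)    _      = a₁≢w
    a≢w (suc (suc i)) i+2≤m aᵢ₊₂≡w
      with degree≡2⇒neighbour (a-degree _ i+2≤m) (~-sym (adjacent a-path (suc i) i+2≤m))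
             (subst (_~ a 0) (sym aᵢ₊₂≡w) (~-sym a₀~w))
             (λ aᵢ₊₁≡a₀ → contradiction (injective a-path _ _ (<⇒≤ i+2≤m) z≤n aᵢ₊₁≡a₀) λ ())
             (subst (_~ b 0) (sym aᵢ₊₂≡w) (~-sym b₀~w))
    ... | inj₁ b₀≡aᵢ₊₁ = a≢b _ 0 (<⇒≤ i+2≤m) z≤n (sym b₀≡aᵢ₊₁)
    ... | inj₂ b₀≡a₀   = a≢b 0 0 z≤n z≤n (sym b₀≡a₀)

    neighbour-a₀ : ∀ {z} → a 0 ~ z → z ≡ a 1 ⊎ z ≡ w
    neighbour-a₀ = degree≡2⇒neighbour (a-degree 0 z≤n) (adjacent a-path 0 (<⇒≤ 2≤m)) a₀~w a₁≢w

    interior≁w : ∀ t → suc t < m → ¬ a (suc t) ~ w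
    interior≁w t t+2≤m aₜ₊₁~w with unbranched t t+2≤m aₜ₊₁~w
    ... | inj₁ w≡aₜ   = a≢w t (<⇒≤ (<⇒≤ t+2≤m)) (sym w≡aₜ)
    ... | inj₂ w≡aₜ₊₂ = a≢w _ t+2≤m (sym w≡aₜ₊₂)

  -- k = 7 + j: the threads are u 0 … u m and v 0 … v m with m = k - 4, and a path on k vertices
  -- has last index K = k - 1.
  module TwoThreads {j : ℕ} (saturated : Saturated (7 + j) G) {u v : ℕ → Fin n} {w : Fin n}
                    (u-path : Path (3 + j) u) (v-path : Path (3 + j) v)
                    (u-degree : ∀ i → i ≤ 3 + j → degree G (u i) ≡ 2)
                    (v-degree : ∀ i → i ≤ 3 + j → degree G (v i) ≡ 2)
                    (u≢v : ∀ i i′ → i ≤ 3 + j → i′ ≤ 3 + j → u i ≢ v i′)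
                    (u₀~w : u 0 ~ w) (v₀~w : v 0 ~ w) where

    m K : ℕ
    m = 3 + j
    K = 3 + m

    2≤m : 2 ≤ m
    2≤m = s≤s (s≤s z≤n)

    3≤m : 3 ≤ m
    3≤m = s≤s (s≤s (s≤s z≤n))

    m≤K : m ≤ K
    m≤K = m≤n+m m 3

    m<K : m < K
    m<K = s≤s (m≤n+m m 2)

    m+1<K : suc m < K
    m+1<K = s≤s (s≤s (n≤1+n m))

    4≤K : 4 ≤ K
    4≤K = ≤-trans (s≤s 3≤m) m<K

    module U = Thread 2≤m u-path u-degree u≢v u₀~w v₀~w
    module V = Thread 2≤m v-path v-degree (λ i i′ i≤m i′≤m → u≢v i′ i i′≤m i≤m ∘ sym) v₀~w u₀~w

    k-path : ∀ {x y} → x ≢ y → ¬ x ~ y → ∃ λ p → Path K p × p 0 ≡ x × p K ≡ y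
    k-path = saturated⇒path (s≤s (s≤s z≤n)) saturated

    u₀≁v : ∀ i → i ≤ 1 → ¬ u 0 ~ v i
    u₀≁v i i≤1 u₀~vᵢ with U.neighbour-a₀ u₀~vᵢ
    ... | inj₁ vᵢ≡u₁ = u≢v 1 i (<⇒≤ 2≤m) (≤-trans i≤1 (<⇒≤ 2≤m)) (sym vᵢ≡u₁)
    ... | inj₂ vᵢ≡w  = V.a≢w i (≤-trans i≤1 (<⇒≤ 2≤m)) vᵢ≡w

    u₀v₀-path⇒an-end-meets-w : ∀ {q} → Path K q → q 0 ≡ u 0 → q K ≡ v 0 →
                               CommonNeighbour (v m) w ⊎ CommonNeighbour (u m) w
    u₀v₀-path⇒an-end-meets-w {q} π q₀≡u₀ q_K≡v₀ =
      cases (U.neighbour-a₀ (subst (_~ q 1) q₀≡u₀ (adjacent π 0 z<s)))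
            (V.neighbour-a₀ (subst (_~ q (2 + m)) q_K≡v₀ (~-sym (adjacent π (2 + m) ≤-refl))))
      where
      q-follows-u : q 1 ≡ u 1 → ∀ t → t ≤ m → q t ≡ u t
      q-follows-u = follow π m≤K U.unbranched q₀≡u₀
      q₃≡vₘ : q (2 + m) ≡ v 1 → q 3 ≡ v m
      q₃≡vₘ q_K-1≡v₁ = trans (cong q (sym (m+n∸n≡m 3 m)))
                             (follow (reverse π) m≤K V.unbranched q_K≡v₀ q_K-1≡v₁ m ≤-refl)
      cases : q 1 ≡ u 1 ⊎ q 1 ≡ w → q (2 + m) ≡ v 1 ⊎ q (2 + m) ≡ w →
              CommonNeighbour (v m) w ⊎ CommonNeighbour (u m) w
      cases (inj₂ q₁≡w) (inj₂ q_K-1≡w) =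
        contradiction (injective π 1 (2 + m) (s≤s z≤n) (n≤1+n _) (trans q₁≡w (sym q_K-1≡w))) λ ()
      cases (inj₂ q₁≡w) (inj₁ q_K-1≡v₁) =
        inj₁ (q 2 , subst (_~ q 2) (q₃≡vₘ q_K-1≡v₁) (~-sym (adjacent π 2 (<⇒≤ 4≤K)))
                  , subst (_~ q 2) q₁≡w (adjacent π 1 (s≤s (s≤s z≤n))))
      cases (inj₁ q₁≡u₁) (inj₁ q_K-1≡v₁) =
        contradiction (trans (sym (q-follows-u q₁≡u₁ 3 3≤m)) (q₃≡vₘ q_K-1≡v₁)) (u≢v 3 m 3≤m ≤-refl)
      cases (inj₁ q₁≡u₁) (inj₂ q_K-1≡w) =
        inj₂ (q (suc m) , subst (_~ q (suc m)) (q-follows-u q₁≡u₁ m ≤-refl) (adjacent π m m<K)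
                        , subst (_~ q (suc m)) q_K-1≡w (~-sym (adjacent π (suc m) m+1<K)))

    an-end-meets-w : CommonNeighbour (v m) w ⊎ CommonNeighbour (u m) w
    an-end-meets-w with k-path (u≢v 0 0 z≤n z≤n) (u₀≁v 0 z≤n)
    ... | q , π , q₀≡u₀ , q_K≡v₀ = u₀v₀-path⇒an-end-meets-w π q₀≡u₀ q_K≡v₀

    u₀v₁-path⇒u-end-links : ∀ {p} → Path K p → p 0 ≡ u 0 → p K ≡ v 1 → u m ~ w ⊎ u m ~ v m
    u₀v₁-path⇒u-end-links {p} π p₀≡u₀ p_K≡v₁ =
      starts (U.neighbour-a₀ (subst (_~ p 1) p₀≡u₀ (adjacent π 0 z<s)))
      where
      starts : p 1 ≡ u 1 ⊎ p 1 ≡ w → u m ~ w ⊎ u m ~ v m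
      starts (inj₂ p₁≡w) = contradiction (close (cons (tail π) v₀∉p v₀~p₁) p_K~v₀) (proj₁ saturated)
        where
        v₀~p₁ : v 0 ~ p 1
        v₀~p₁ = subst (v 0 ~_) (sym p₁≡w) v₀~w
        p_K~v₀ : p K ~ v 0
        p_K~v₀ = subst (_~ v 0) (sym p_K≡v₁) (~-sym (adjacent v-path 0 z<s))
        v₀≁p : ∀ s → 1 < s → s < K → ¬ v 0 ~ p s
        v₀≁p s 1<s s<K v₀~pₛ with V.neighbour-a₀ v₀~pₛ
        ... | inj₁ pₛ≡v₁ = <⇒≢ s<K (injective π s K (<⇒≤ s<K) ≤-refl (trans pₛ≡v₁ (sym p_K≡v₁)))
        ... | inj₂ pₛ≡w  = <⇒≢ 1<s (sym (injective π s 1 (<⇒≤ s<K) (s≤s z≤n) (trans pₛ≡w (sym p₁≡w))))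
        -- p 2 = v 0 is refuted via p 3: its predecessor p 1 = w is a genuine neighbour of v 0
        v₀∉p : ∀ i → i ≤ 2 + m → p (suc i) ≢ v 0
        v₀∉p zero          _       p₁≡v₀   = ~⇒≢ v₀~w (trans (sym p₁≡v₀) p₁≡w)
        v₀∉p (suc zero)    _       p₂≡v₀   =
          v₀≁p 3 (s≤s (s≤s z≤n)) 4≤K (subst (_~ p 3) p₂≡v₀ (adjacent π 2 (<⇒≤ 4≤K)))
        v₀∉p (suc (suc i)) i+2≤m+2 pᵢ₊₃≡v₀ =
          v₀≁p (2 + i) (s≤s (s≤s z≤n)) (s≤s i+2≤m+2)
               (subst (_~ p (2 + i)) pᵢ₊₃≡v₀ (~-sym (adjacent π (2 + i) (s≤s i+2≤m+2))))
      starts (inj₁ p₁≡u₁) =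
        ends (V.unbranched 0 2≤m (subst (_~ p (2 + m)) p_K≡v₁ (~-sym (adjacent π (2 + m) ≤-refl))))
        where
        p-follows-u : ∀ t → t ≤ m → p t ≡ u t
        p-follows-u = follow π m≤K U.unbranched p₀≡u₀ p₁≡u₁
        v-tail-unbranched : Unbranched (2 + j) (v ∘ suc)
        v-tail-unbranched = degree≡2⇒unbranched (tail v-path) (λ i i≤m-1 → v-degree (suc i) (s≤s i≤m-1))
        p₄≡vₘ : p (2 + m) ≡ v 2 → p 4 ≡ v m
        p₄≡vₘ p_K-1≡v₂ = trans (cong p (sym (m+n∸n≡m 4 (2 + j))))
          (follow (reverse π) (m≤n+m (2 + j) 4) v-tail-unbranched p_K≡v₁ p_K-1≡v₂ (2 + j) ≤-refl)
        ends : p (2 + m) ≡ v 0 ⊎ p (2 + m) ≡ v 2 → u m ~ w ⊎ u m ~ v m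
        ends (inj₁ p_K-1≡v₀)
          with V.neighbour-a₀ (subst (_~ p (suc m)) p_K-1≡v₀ (~-sym (adjacent π (suc m) m+1<K)))
        ... | inj₁ pₘ₊₁≡v₁ =
          contradiction (injective π (suc m) K (<⇒≤ m+1<K) ≤-refl (trans pₘ₊₁≡v₁ (sym p_K≡v₁))) (<⇒≢ m+1<K)
        ... | inj₂ pₘ₊₁≡w  = inj₁ (subst₂ _~_ (p-follows-u m ≤-refl) pₘ₊₁≡w (adjacent π m m<K))
        ends (inj₂ p_K-1≡v₂) with 4 ≤? m
        ... | yes 4≤m = contradiction (trans (sym (p-follows-u 4 4≤m)) (p₄≡vₘ p_K-1≡v₂)) (u≢v 4 m 4≤m ≤-refl)
        ... | no 4≰m  = inj₂ (subst₂ _~_ p₃≡uₘ (p₄≡vₘ p_K-1≡v₂) (adjacent π 3 4≤K))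
          where
          p₃≡uₘ : p 3 ≡ u m
          p₃≡uₘ = trans (p-follows-u 3 3≤m) (cong u (≤-antisym 3≤m (s≤s⁻¹ (≰⇒> 4≰m))))

    u-end-links : u m ~ w ⊎ u m ~ v m
    u-end-links with k-path (u≢v 0 1 z≤n (s≤s z≤n)) (u₀≁v 1 ≤-refl)
    ... | p , π , p₀≡u₀ , p_K≡v₁ = u₀v₁-path⇒u-end-links π p₀≡u₀ p_K≡v₁

    v-end-cannot-link : CommonNeighbour (v m) w → ¬ (v m ~ w ⊎ v m ~ u m)
    v-end-cannot-link (z , vₘ~z , w~z) = [ vₘ≁w , vₘ≁uₘ ]
      where
      vₘ₋₁≢z : v (2 + j) ≢ z
      vₘ₋₁≢z vₘ₋₁≡z = V.interior≁w (1 + j) ≤-refl (subst (_~ w) (sym vₘ₋₁≡z) (~-sym w~z))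
      neighbour-vₘ : ∀ {y} → v m ~ y → y ≡ v (2 + j) ⊎ y ≡ z
      neighbour-vₘ =
        degree≡2⇒neighbour (v-degree m ≤-refl) (~-sym (adjacent v-path (2 + j) ≤-refl)) vₘ~z vₘ₋₁≢z
      vₘ≁w : ¬ v m ~ w
      vₘ≁w vₘ~w = [ V.a≢w (2 + j) (n≤1+n _) ∘ sym , ~⇒≢ w~z ] (neighbour-vₘ vₘ~w)
      vₘ≁uₘ : ¬ v m ~ u m
      vₘ≁uₘ vₘ~uₘ with neighbour-vₘ vₘ~uₘ
      ... | inj₁ uₘ≡vₘ₋₁ = u≢v m (2 + j) ≤-refl (n≤1+n _) uₘ≡vₘ₋₁
      ... | inj₂ uₘ≡z = [ U.a≢w (2 + j) (n≤1+n _) ∘ sym , V.a≢w m ≤-refl ∘ sym ]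
              (degree≡2⇒neighbour (u-degree m ≤-refl) (~-sym (adjacent u-path (2 + j) ≤-refl)) (~-sym vₘ~uₘ)
                                  (u≢v (2 + j) m (n≤1+n _) ≤-refl) (subst (_~ w) (sym uₘ≡z) (~-sym w~z)))

lemma4p4 : (k : ℕ) → 7 ≤ k → (n : ℕ) → (G : Graph n) → Saturated k G →
    (u v : Fin (suc (k ∸ 4)) → Fin n) →
    IsPath G (k ∸ 4) u → IsPath G (k ∸ 4) v →
    (∀ i j → u i ≢ v j) →
    (∀ i → degree G (u i) ≡ 2) → (∀ i → degree G (v i) ≡ 2) →
    ¬ (∃ λ w → Adjacent G (u zero) w × Adjacent G (v zero) w)
lemma4p4 _ (s≤s (s≤s (s≤s (s≤s (s≤s (s≤s (s≤s (z≤n {j}))))))))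
         n G saturated u v u-path v-path u≢v u-degree v-degree (w , u₀~w , v₀~w) =
  [ (λ vₘ-meets-w → UV.v-end-cannot-link vₘ-meets-w VU.u-end-links)
  , (λ uₘ-meets-w → VU.v-end-cannot-link uₘ-meets-w UV.u-end-links)
  ] UV.an-end-meets-w
  where
  module UV = TwoThreads G saturated (isPath⇒path G u-path) (isPath⇒path G v-path)
                (λ _ _ → u-degree _) (λ _ _ → v-degree _) (λ _ _ _ _ → u≢v _ _) u₀~w v₀~w
  module VU = TwoThreads G saturated (isPath⇒path G v-path) (isPath⇒path G u-path)
                (λ _ _ → v-degree _) (λ _ _ → u-degree _) (λ _ _ _ _ → u≢v _ _ ∘ sym) v₀~w u₀~w
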